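{- Let $G$ be a graph and $B\subseteq V(G)$. If $B$ is a zero forcing set for $G$, then $B$ is a lazy burning set for the closed neighborhood hypergraph $\mathcal{N}[G]$. In particular, $b_L(\mathcal{N}[G])\le z(G)$.
   Context: Graphs are finite and simple. Zero forcing on $G$: an initial set of vertices is black, the rest white; repeatedly, a black vertex $u$ with exactly one white neighbor $w$ turns $w$ black. A zero forcing set is an initial black set from which all vertices eventually become black; $z(G)$ is the minimum size of one. The closed neighborhood hypergraph $\mathcal{N}[G]$ has vertex set $V(G)$ and hyperedges $N_G[v]=N_G(v)\cup\{v\}$ for $v\in V(G)$. Lazy burning on a hypergraph $H$: a set $B\subseteq V(H)$ is burned initially; in each subsequent round every unburned vertex $v$ for which some hyperedge $h\ni v$ has $h\setminus\{v\}$ entirely burned becomes burned. $B$ is a lazy burning set if eventually all vertices burn; $b_L(H)$ is the minimum size of one. -}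

module Defs where

open import Data.Nat using (ℕ; _≤_)
open import Data.Fin using (Fin)
open import Data.Fin.Subset using (Subset; _∈_; ∣_∣)
open import Data.Product using (_×_; Σ)
open import Data.Sum using (_⊎_)
open import Relation.Binary.PropositionalEquality using (_≡_)
open import Relation.Nullary using (¬_)
open import Level using (0ℓ; suc)

record Graph : Set₁ where
  field
    n     : ℕ
    Adj   : Fin n → Fin n → Set
    sym   : ∀ {u v} → Adj u v → Adj v u
    irrefl : ∀ {u} → ¬ Adj u u

record Hypergraph : Set₁ where
  field
    n     : ℕ
    m     : ℕ
    _∈ₑ_  : Fin n → Fin m → Set

N[_] : Graph → Hypergraph
N[ G ] = record { n = Graph.n G ; m = Graph.n G ; _∈ₑ_ = λ x v → x ≡ v ⊎ Graph.Adj G v x }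

data Black (G : Graph) (B : Subset (Graph.n G)) : Fin (Graph.n G) → Set where
  initial : ∀ {v} → v ∈ B → Black G B v
  force   : ∀ {u w} → Black G B u → Graph.Adj G u w →
            (∀ w' → Graph.Adj G u w' → ¬ w' ≡ w → Black G B w') →
            Black G B w

IsZeroForcingSet : (G : Graph) → Subset (Graph.n G) → Set
IsZeroForcingSet G B = ∀ v → Black G B v

data Burned (H : Hypergraph) (B : Subset (Hypergraph.n H)) : Fin (Hypergraph.n H) → Set where
  initial : ∀ {v} → v ∈ B → Burned H B v
  spread  : ∀ {v} (h : Fin (Hypergraph.m H)) → Hypergraph._∈ₑ_ H v h →
            (∀ x → Hypergraph._∈ₑ_ H x h → ¬ x ≡ v → Burned H B x) →
            Burned H B v

IsLazyBurningSet : (H : Hypergraph) → Subset (Hypergraph.n H) → Set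
IsLazyBurningSet H B = ∀ v → Burned H B v

IsMinSize : {n : ℕ} → (Subset n → Set) → ℕ → Set
IsMinSize {n} P k = Σ (Subset n) (λ S → P S × ∣ S ∣ ≡ k) × (∀ S → P S → k ≤ ∣ S ∣)

IsZeroForcingNumber : (G : Graph) → ℕ → Set
IsZeroForcingNumber G = IsMinSize (IsZeroForcingSet G)

IsLazyBurningNumber : (H : Hypergraph) → ℕ → Set
IsLazyBurningNumber H = IsMinSize (IsLazyBurningSet H)

module Submission where

open import Defs
open import Data.Nat using (ℕ; _≤_)
open import Data.Fin.Subset using (Subset)
open import Data.Product using (_×_; _,_)
open import Data.Sum using (inj₁; inj₂)
open import Relation.Binary.PropositionalEquality using (refl)

-- A force u → w is a lazy-burning step along the hyperedge N[u]: every vertex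
-- of N[u] other than w is u itself or a neighbour of u, all already black.
black⇒burned : (G : Graph) (B : Subset (Graph.n G)) →
               ∀ {v} → Black G B v → Burned N[ G ] B v
black⇒burned G B (initial v∈B) = initial v∈B
black⇒burned G B (force {u} black-u u~w others-black) =
  spread u (inj₂ u~w) λ
    { x (inj₁ refl) _   → black⇒burned G B black-u
    ; x (inj₂ u~x) x≢w → black⇒burned G B (others-black x u~x x≢w)
    }

zeroForcing⇒lazyBurning : (G : Graph) (B : Subset (Graph.n G)) →
                          IsZeroForcingSet G B → IsLazyBurningSet N[ G ] B
zeroForcing⇒lazyBurning G B zf v = black⇒burned G B (zf v)

minSize-mono : ∀ {n} {P Q : Subset n → Set} → (∀ S → P S → Q S) →
               ∀ {p q} → IsMinSize P p → IsMinSize Q q → q ≤ p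
minSize-mono P⇒Q ((S , PS , refl) , _) (_ , q-min) = q-min S (P⇒Q S PS)

theorem4p4 : (G : Graph) →
    ((B : Subset (Graph.n G)) → IsZeroForcingSet G B → IsLazyBurningSet N[ G ] B) ×
    ((z b : ℕ) → IsZeroForcingNumber G z → IsLazyBurningNumber N[ G ] b → b ≤ z)
theorem4p4 G =
  zeroForcing⇒lazyBurning G ,
  λ z b → minSize-mono (zeroForcing⇒lazyBurning G)
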